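{- In the LGV diagram, let $L$ be the collection of left greedy paths starting at the sources $1,\dots,n$. Then $L$ is a non-intersecting path collection, it is the unique non-intersecting path collection from $\{1,\dots,n\}$ to its own sink set, and every arrow of the LGV diagram is used by some path of $L$. Moreover, if the left greedy path starting at source $i\in[n]$ ends at sink $j$, then no path starting at source $i$ ends at a strand lying above strand $j$.
   Context: Let $n\ge 2$, $N=\binom n2$, and let $(i_1,\dots,i_N)$ be the index sequence of the word $B_1\cdots B_{\lfloor n/2\rfloor}$ in symbols $s_1,\dots,s_n$, where $B_m=s_n(s_{n-2}s_{n-3}\cdots s_{2m-1})(s_{n-1}s_{n-2}\cdots s_{2m})$ and a descending product $s_a\cdots s_b$ is empty if $a<b$. LGV diagram: $2n$ horizontal strands labeled by $[2n]$, ordered from bottom to top as $1,2,\dots,n,2n,2n-1,\dots,n+1$ ("above" refers to this order). At each step $l=1,\dots,N$ there are two arrows: if $i_l=i<n$, an arrow from strand $i$ to strand $i+1$ and an arrow from strand $n+i+1$ to strand $n+i$; if $i_l=n$, an arrow from strand $n-1$ to strand $2n$ and an arrow from strand $n$ to strand $2n-1$. A path from source $a$ to sink $b$ is a sequence of strands $(c_0,\dots,c_N)$ with $c_0=a$, $c_N=b$, and for each $l$ either $c_l=c_{l-1}$ or there is an arrow at step $l$ from $c_{l-1}$ to $c_l$ (the path then uses that arrow). The left greedy path from $a$ is the path that, at every step $l$, uses the arrow at step $l$ starting on its current strand whenever such an arrow exists. A path collection from $S$ to $T$ is a family of paths with source set $S$ and sink set $T$; it is non-intersecting if no two paths are on the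 same strand at the same time $l\in\{0,\dots,N\}$. -}

module Defs where

open import Data.Nat using (ℕ; zero; suc; _+_; _*_; _∸_; _≤_; _<_; _<ᵇ_; _≡ᵇ_; _≤ᵇ_)
open import Data.Nat.DivMod using (_/_)
open import Data.Nat.Combinatorics using (_C_)
open import Data.Bool using (if_then_else_)
open import Data.List using (List; []; _∷_; _++_)
open import Data.List.Membership.Propositional using (_∈_)
open import Data.Product using (_×_; _,_; ∃)
open import Data.Sum using (_⊎_)
open import Relation.Binary.PropositionalEquality using (_≡_; _≢_)

N : ℕ → ℕ
N n = n C 2

-- descending product s_a s_{a-1} ⋯ s_b  (empty if a < b), as a list of indices
descAux : ℕ → ℕ → List ℕ
descAux zero    a = []
descAux (suc k) a = a ∷ descAux k (a ∸ 1)

desc : ℕ → ℕ → List ℕ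
desc a b = descAux (suc a ∸ b) a

B : ℕ → ℕ → List ℕ
B n m = n ∷ (desc (n ∸ 2) (2 * m ∸ 1) ++ desc (n ∸ 1) (2 * m))

blocks : ℕ → ℕ → List ℕ
blocks n zero    = []
blocks n (suc k) = blocks n k ++ B n (suc k)

word : ℕ → List ℕ
word n = blocks n (n / 2)

-- the l-th entry (1-indexed) of a list; default 0 outside the range
at : List ℕ → ℕ → ℕ
at []       _             = 0
at (x ∷ xs) zero          = 0
at (x ∷ xs) (suc zero)    = x
at (x ∷ xs) (suc (suc l)) = at xs (suc l)

idx : ℕ → ℕ → ℕ
idx n l = at (word n) l

-- the two arrows (from , to) present at a step labelled by the symbol s_i
arrows : ℕ → ℕ → List (ℕ × ℕ)
arrows n i =
  if i <ᵇ n then (i , suc i) ∷ (n + i + 1 , n + i) ∷ []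
  else if i ≡ᵇ n then (n ∸ 1 , 2 * n) ∷ (n , 2 * n ∸ 1) ∷ []
  else []

Arrow : ℕ → ℕ → ℕ → ℕ → Set
Arrow n l a b = (a , b) ∈ arrows n (idx n l)

-- a path (c_0,…,c_N) is a function c : ℕ → ℕ (only values at 0..N matter)
IsPath : ℕ → (ℕ → ℕ) → ℕ → ℕ → Set
IsPath n c a b =
  c 0 ≡ a × c (N n) ≡ b ×
  (∀ l → l < N n → c (suc l) ≡ c l ⊎ Arrow n (suc l) (c l) (c (suc l)))

greedyStep : List (ℕ × ℕ) → ℕ → ℕ
greedyStep []             c = c
greedyStep ((a , b) ∷ as) c = if a ≡ᵇ c then b else greedyStep as c

greedy : ℕ → ℕ → ℕ → ℕ
greedy n a zero    = a
greedy n a (suc l) = greedyStep (arrows n (idx n (suc l))) (greedy n a l)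

InN : ℕ → ℕ → Set
InN n a = 1 ≤ a × a ≤ n

-- position of a strand in the bottom-to-top order 1,…,n,2n,2n-1,…,n+1
pos : ℕ → ℕ → ℕ
pos n c = if c ≤ᵇ n then c else (3 * n + 1) ∸ c

Above : ℕ → ℕ → ℕ → Set
Above n k j = pos n j < pos n k

PathCollectionFromSources : ℕ → (ℕ → ℕ → ℕ) → Set
PathCollectionFromSources n P = ∀ a → InN n a → IsPath n (P a) a (P a (N n))

IsSink : ℕ → (ℕ → ℕ → ℕ) → ℕ → Set
IsSink n P k = ∃ λ a → InN n a × P a (N n) ≡ k

SameSinkSet : ℕ → (ℕ → ℕ → ℕ) → (ℕ → ℕ → ℕ) → Set
SameSinkSet n P Q = ∀ k → (IsSink n P k → IsSink n Q k) × (IsSink n Q k → IsSink n P k)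

NonIntersecting : ℕ → (ℕ → ℕ → ℕ) → Set
NonIntersecting n P =
  ∀ a b → InN n a → InN n b → a ≢ b → ∀ l → l ≤ N n → P a l ≢ P b l

-- Each step of the word has two properties.  Locally, its arrows go up in the bottom-to-top
-- order pos, have distinct tails, and every strand an arrow passes over is itself a head or is
-- carried past that arrow's head.  Globally ("admissibility"), the left greedy paths from 1,…,n
-- occupy every tail and no head at the moment the step is taken.  Together these make the
-- greedy step strictly order-preserving on occupied strands: the greedy paths stay ordered by
-- source (so they do not intersect), every arrow is used, and any path from i stays weakly
-- below the greedy path from i and, once strictly below, stays strictly below.  Comparing
-- sinks from the highest source downwards then forces every collection with the same sinks to
-- be the greedy one.
--
-- Admissibility is checked by following the greedy configuration through each block B_m:
-- before it, the sources 1,…,n-2m+2 sit on strands 2m-1,…,n and the others on the upper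
-- strands n+1,…,n+2m-2; s_n lifts the two top sources to 2n and 2n-1, and each descending run
-- shifts the remaining lower sources up by one while one upper source walks down the upper
-- strands past everybody else.

module Submission where

open import Defs
open import Data.Nat using (ℕ; zero; suc; _+_; _*_; _∸_; _≤_; _<_; _≡ᵇ_; _<ᵇ_; _≤ᵇ_; z≤n; s≤s; z<s)
open import Data.Nat.Properties
open import Data.Nat.DivMod using (_/_; _%_; m%n≡m∸m/n*n; m%n<n; m/n*n≤m)
open import Data.Nat.Combinatorics using (nCk+nC[k+1]≡[n+1]C[k+1]; nC1≡n) renaming (_C_ to _choose_)
open import Data.Nat.Tactic.RingSolver using (solve-∀)
open import Data.Bool using (true; false; T)
open import Data.Empty using (⊥-elim)
open import Data.Unit using (⊤; tt)
open import Data.List using (List; []; _∷_; _++_; foldl; length)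
open import Data.List.Properties using (foldl-++; length-++)
open import Data.List.Membership.Propositional using (_∈_)
open import Data.List.Relation.Unary.Any using (here; there)
open import Data.Product using (_×_; _,_; ∃; proj₁; proj₂)
open import Data.Sum using (_⊎_; inj₁; inj₂)
open import Function using (_∘_; id)
open import Relation.Binary using (tri<; tri≈; tri>)
open import Relation.Binary.PropositionalEquality
open import Relation.Nullary using (¬_; yes; no)

Arrows : Set
Arrows = List (ℕ × ℕ)

Move : Arrows → ℕ → ℕ → Set
Move L x x' = x' ≡ x ⊎ (x , x') ∈ L

Head : Arrows → ℕ → Set
Head L y = ∃ λ x → (x , y) ∈ L

greedyStep-moves : ∀ L c → Move L c (greedyStep L c)
greedyStep-moves []             c = inj₁ refl
greedyStep-moves ((x , y) ∷ L) c with x ≡ᵇ c in eq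
... | true  = inj₂ (here (cong (_, y) (sym (≡ᵇ⇒≡ x c (subst T (sym eq) tt)))))
... | false with greedyStep-moves L c
...   | inj₁ stay  = inj₁ stay
...   | inj₂ arrow = inj₂ (there arrow)

greedyStep-hit : ∀ x y L → greedyStep ((x , y) ∷ L) x ≡ y
greedyStep-hit x y L with x ≡ᵇ x in eq
... | true  = refl
... | false = ⊥-elim (subst T eq (≡⇒≡ᵇ x x refl))

greedyStep-miss : ∀ x y L {c} → x ≢ c → greedyStep ((x , y) ∷ L) c ≡ greedyStep L c
greedyStep-miss x y L {c} x≢c with x ≡ᵇ c in eq
... | true  = ⊥-elim (x≢c (≡ᵇ⇒≡ x c (subst T (sym eq) tt)))
... | false = refl

lowArrows : ℕ → ℕ → Arrows
lowArrows n i = (i , suc i) ∷ (n + i + 1 , n + i) ∷ []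

topArrows : ℕ → Arrows
topArrows n = (n ∸ 1 , 2 * n) ∷ (n , 2 * n ∸ 1) ∷ []

arrows-low : ∀ {n i} → i < n → arrows n i ≡ lowArrows n i
arrows-low {n} {i} i<n with i <ᵇ n in lt
... | true  = refl
... | false = ⊥-elim (subst T lt (<⇒<ᵇ i<n))

arrows-top : ∀ n → arrows n n ≡ topArrows n
arrows-top n with n <ᵇ n in lt | n ≡ᵇ n in eq
... | false | true  = refl
... | false | false = ⊥-elim (subst T eq (≡⇒≡ᵇ n n refl))
... | true  | _     = ⊥-elim (<-irrefl refl (<ᵇ⇒< n n (subst T (sym lt) tt)))

i<n+i+1 : ∀ n i → i < n + i + 1
i<n+i+1 n i = ≤-<-trans (m≤n+m i n) (m<m+n (n + i) z<s)

module _ {n i : ℕ} (i<n : i < n) where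

  lowStep-lower : greedyStep (arrows n i) i ≡ suc i
  lowStep-lower rewrite arrows-low i<n = greedyStep-hit i (suc i) ((n + i + 1 , n + i) ∷ [])

  lowStep-upper : greedyStep (arrows n i) (n + i + 1) ≡ n + i
  lowStep-upper rewrite arrows-low i<n =
    trans (greedyStep-miss i (suc i) ((n + i + 1 , n + i) ∷ []) (<⇒≢ (i<n+i+1 n i))) (greedyStep-hit (n + i + 1) (n + i) [])

  lowStep-idle : ∀ {x} → x ≢ i → x ≢ n + i + 1 → greedyStep (arrows n i) x ≡ x
  lowStep-idle x≢i x≢j rewrite arrows-low i<n =
    trans (greedyStep-miss i (suc i) ((n + i + 1 , n + i) ∷ []) (x≢i ∘ sym))
          (greedyStep-miss (n + i + 1) (n + i) [] (x≢j ∘ sym))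

Strand : ℕ → ℕ → Set
Strand n x = 1 ≤ x × x ≤ 2 * n

pos-lower : ∀ {n x} → x ≤ n → pos n x ≡ x
pos-lower {n} {x} x≤n with x ≤ᵇ n in eq
... | true  = refl
... | false = ⊥-elim (subst T eq (≤⇒≤ᵇ x≤n))

pos-upper : ∀ {n x} → n < x → pos n x ≡ 3 * n + 1 ∸ x
pos-upper {n} {x} n<x with x ≤ᵇ n in eq
... | false = refl
... | true  = ⊥-elim (<⇒≱ n<x (≤ᵇ⇒≤ x n (subst T (sym eq) tt)))

pos-upper-≡ : ∀ {n x p} → n < x → p + x ≡ 3 * n + 1 → pos n x ≡ p
pos-upper-≡ {n} {x} {p} n<x e = trans (pos-upper n<x) (trans (cong (_∸ x) (sym e)) (m+n∸n≡m p x))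

2n+[1+n]≡3n+1 : ∀ n → 2 * n + suc n ≡ 3 * n + 1
2n+[1+n]≡3n+1 = solve-∀

pos-upper-> : ∀ {n x} → n < x → x ≤ 2 * n → n < pos n x
pos-upper-> {n} {x} n<x x≤2n = begin-strict
  n                      <⟨ n<1+n n ⟩
  suc n                  ≡⟨ sym (m+n∸m≡n (2 * n) (suc n)) ⟩
  2 * n + suc n ∸ 2 * n  ≡⟨ cong (_∸ 2 * n) (2n+[1+n]≡3n+1 n) ⟩
  3 * n + 1 ∸ 2 * n      ≤⟨ ∸-monoʳ-≤ (3 * n + 1) x≤2n ⟩
  3 * n + 1 ∸ x          ≡⟨ sym (pos-upper n<x) ⟩
  pos n x                ∎
  where open ≤-Reasoning

pos-lower≢upper : ∀ {n x y} → x ≤ n → n < y → y ≤ 2 * n → pos n x ≢ pos n y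
pos-lower≢upper x≤n n<y y≤2n e =
  <⇒≱ (pos-upper-> n<y y≤2n) (subst (_≤ _) (trans (sym (pos-lower x≤n)) e) x≤n)

pos-injective : ∀ {n x y} → Strand n x → Strand n y → pos n x ≡ pos n y → x ≡ y
pos-injective {n} {x} {y} (_ , x≤2n) (_ , y≤2n) e with x ≤? n | y ≤? n
... | yes x≤n | yes y≤n = trans (sym (pos-lower x≤n)) (trans e (pos-lower y≤n))
... | yes x≤n | no y≰n  = ⊥-elim (pos-lower≢upper x≤n (≰⇒> y≰n) y≤2n e)
... | no x≰n  | yes y≤n = ⊥-elim (pos-lower≢upper y≤n (≰⇒> x≰n) x≤2n (sym e))
... | no x≰n  | no y≰n  =
  ∸-cancelˡ-≡ (≤-trans x≤2n 2n≤3n+1) (≤-trans y≤2n 2n≤3n+1)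
    (trans (sym (pos-upper (≰⇒> x≰n))) (trans e (pos-upper (≰⇒> y≰n))))
  where
  2n≤3n+1 : 2 * n ≤ 3 * n + 1
  2n≤3n+1 = ≤-trans (m≤m+n (2 * n) (suc n)) (≤-reflexive (2n+[1+n]≡3n+1 n))

record WellFormed (n : ℕ) (L : Arrows) : Set where
  field
    head-strand   : ∀ {x y} → (x , y) ∈ L → Strand n y
    ascending     : ∀ {x y} → (x , y) ∈ L → pos n x < pos n y
    deterministic : ∀ {x y} → (x , y) ∈ L → greedyStep L x ≡ y
    overtaken     : ∀ {x y q} → (x , y) ∈ L → Strand n q → pos n x < pos n q → pos n q ≤ pos n y →
                    Head L q ⊎ pos n y < pos n (greedyStep L q)

module _ {n : ℕ} {L : Arrows} (wf : WellFormed n L) where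
  open WellFormed wf

  greedyStep-inflationary : ∀ x → pos n x ≤ pos n (greedyStep L x)
  greedyStep-inflationary x with greedyStep-moves L x
  ... | inj₁ stay  = ≤-reflexive (cong (pos n) (sym stay))
  ... | inj₂ arrow = <⇒≤ (ascending arrow)

  move-strand : ∀ {x x'} → Strand n x → Move L x x' → Strand n x'
  move-strand sx (inj₁ refl)  = sx
  move-strand sx (inj₂ arrow) = head-strand arrow

  move≤greedyStep : ∀ {x x'} → Move L x x' → pos n x' ≤ pos n (greedyStep L x)
  move≤greedyStep {x} (inj₁ refl) = greedyStep-inflationary x
  move≤greedyStep (inj₂ arrow)    = ≤-reflexive (cong (pos n) (sym (deterministic arrow)))

  greedyStep-strictMono : ∀ {p q} → Strand n q → ¬ Head L q → pos n p < pos n q →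
                          pos n (greedyStep L p) < pos n (greedyStep L q)
  greedyStep-strictMono {p} {q} sq free p<q with greedyStep-moves L p
  ... | inj₁ stay = subst (λ z → pos n z < _) (sym stay) (<-≤-trans p<q (greedyStep-inflationary q))
  ... | inj₂ arrow with pos n q ≤? pos n (greedyStep L p)
  ...   | no q≰y  = <-≤-trans (≰⇒> q≰y) (greedyStep-inflationary q)
  ...   | yes q≤y with overtaken arrow sq p<q q≤y
  ...     | inj₁ head = ⊥-elim (free head)
  ...     | inj₂ y<q' = y<q'

  move-stays-below : ∀ {p p' q} → Strand n q → ¬ Head L q → pos n p < pos n q → Move L p p' →
                     pos n p' < pos n (greedyStep L q)
  move-stays-below sq free p<q mv = ≤-<-trans (move≤greedyStep mv) (greedyStep-strictMono sq free p<q)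

  move-stays-weakly-below : ∀ {p p' q} → Strand n p → Strand n q → ¬ Head L q → pos n p ≤ pos n q →
                            Move L p p' → pos n p' ≤ pos n (greedyStep L q)
  move-stays-weakly-below sp sq free p≤q mv with m≤n⇒m<n∨m≡n p≤q
  ... | inj₁ p<q = <⇒≤ (move-stays-below sq free p<q mv)
  ... | inj₂ p≡q rewrite pos-injective sp sq p≡q = move≤greedyStep mv

unitSteps⇒wellFormed : ∀ {n L} →
  (∀ {x y} → (x , y) ∈ L → Strand n y × pos n y ≡ suc (pos n x)) →
  (∀ {x y} → (x , y) ∈ L → greedyStep L x ≡ y) → WellFormed n L
unitSteps⇒wellFormed {n} {L} unit det = record
  { head-strand   = λ arrow → proj₁ (unit arrow)
  ; ascending     = λ arrow → ≤-reflexive (sym (proj₂ (unit arrow)))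
  ; deterministic = det
  ; overtaken     = λ {x} arrow sq x<q q≤y → inj₁ (x , subst (λ z → (x , z) ∈ L)
      (sym (pos-injective sq (proj₁ (unit arrow))
        (≤-antisym q≤y (subst (_≤ _) (sym (proj₂ (unit arrow))) x<q)))) arrow)
  }

n≤2n : ∀ n → n ≤ 2 * n
n≤2n n = m≤m+n n (n + 0)

n+x≤2n : ∀ {n x} → x ≤ n → n + x ≤ 2 * n
n+x≤2n {n} x≤n = +-monoʳ-≤ n (≤-trans x≤n (≤-reflexive (sym (+-identityʳ n))))

n+i+1≡n+[1+i] : ∀ n i → n + i + 1 ≡ n + suc i
n+i+1≡n+[1+i] n i = trans (+-assoc n i 1) (cong (n +_) (+-comm i 1))

wellFormed-low : ∀ {n i} → 1 ≤ i → i < n → WellFormed n (arrows n i)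
wellFormed-low {n} {i} 1≤i i<n = subst (WellFormed n) (sym (arrows-low i<n)) (unitSteps⇒wellFormed unit det)
  where
  pos-upper-arrow : pos n (n + i) ≡ suc (pos n (n + i + 1))
  pos-upper-arrow = pos-upper-≡ (m<m+n n 1≤i) (begin
    suc (pos n (n + i + 1)) + (n + i)   ≡⟨ sym (+-suc _ (n + i)) ⟩
    pos n (n + i + 1) + suc (n + i)     ≡⟨ cong (pos n (n + i + 1) +_) (+-comm 1 (n + i)) ⟩
    pos n (n + i + 1) + (n + i + 1)     ≡⟨ cong (_+ (n + i + 1)) (pos-upper n<n+i+1) ⟩
    3 * n + 1 ∸ (n + i + 1) + (n + i + 1) ≡⟨ m∸n+n≡m n+i+1≤3n+1 ⟩
    3 * n + 1                           ∎)
    where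
    open ≡-Reasoning
    n<n+i+1 : n < n + i + 1
    n<n+i+1 = subst (n <_) (sym (n+i+1≡n+[1+i] n i)) (m<m+n n z<s)
    n+i+1≤3n+1 : n + i + 1 ≤ 3 * n + 1
    n+i+1≤3n+1 = ≤-trans (≤-reflexive (n+i+1≡n+[1+i] n i))
      (≤-trans (n+x≤2n i<n) (≤-trans (m≤m+n (2 * n) (suc n)) (≤-reflexive (2n+[1+n]≡3n+1 n))))

  unit : ∀ {x y} → (x , y) ∈ lowArrows n i → Strand n y × pos n y ≡ suc (pos n x)
  unit (here refl)         = (s≤s z≤n , ≤-trans i<n (n≤2n n)) , trans (pos-lower i<n) (cong suc (sym (pos-lower (<⇒≤ i<n))))
  unit (there (here refl)) = (≤-trans 1≤i (m≤n+m i n) , n+x≤2n (<⇒≤ i<n)) , pos-upper-arrow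

  det : ∀ {x y} → (x , y) ∈ lowArrows n i → greedyStep (lowArrows n i) x ≡ y
  det (here refl)         = greedyStep-hit i (suc i) ((n + i + 1 , n + i) ∷ [])
  det (there (here refl)) = trans (greedyStep-miss i (suc i) ((n + i + 1 , n + i) ∷ []) (<⇒≢ (i<n+i+1 n i)))
                                  (greedyStep-hit (n + i + 1) (n + i) [])

topArrows-first : ∀ n → greedyStep (topArrows n) (n ∸ 1) ≡ 2 * n
topArrows-first n = greedyStep-hit (n ∸ 1) (2 * n) ((n , 2 * n ∸ 1) ∷ [])

topArrows-second : ∀ {n} → 1 ≤ n → greedyStep (topArrows n) n ≡ 2 * n ∸ 1
topArrows-second {suc m} _ = trans (greedyStep-miss m (2 * suc m) ((suc m , 2 * suc m ∸ 1) ∷ []) (<⇒≢ (n<1+n m)))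
                                   (greedyStep-hit (suc m) (2 * suc m ∸ 1) [])

one-of-two : ∀ {m p} → m < p → p ≤ suc (suc m) → p ≡ suc m ⊎ p ≡ suc (suc m)
one-of-two m<p p≤ssm with m≤n⇒m<n∨m≡n p≤ssm
... | inj₁ p<ssm = inj₁ (≤-antisym (≤-pred p<ssm) m<p)
... | inj₂ p≡ssm = inj₂ p≡ssm

2[1+m]∸1≡[1+m]+m : ∀ m → 2 * suc m ∸ 1 ≡ suc m + m
2[1+m]∸1≡[1+m]+m m = trans (cong (m +_) (+-identityʳ (suc m))) (+-suc m m)

module TopArrows (m : ℕ) (1≤m : 1 ≤ m) where

  n : ℕ
  n = suc m

  2n∸1≡n+m : 2 * n ∸ 1 ≡ n + m
  2n∸1≡n+m = 2[1+m]∸1≡[1+m]+m m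

  strand-n : Strand n n
  strand-n = s≤s z≤n , n≤2n n

  strand-2n : Strand n (2 * n)
  strand-2n = s≤s z≤n , ≤-refl

  strand-2n∸1 : Strand n (2 * n ∸ 1)
  strand-2n∸1 = subst (1 ≤_) (sym 2n∸1≡n+m) (s≤s z≤n) , m∸n≤m (2 * n) 1

  pos-2n : pos n (2 * n) ≡ suc n
  pos-2n = pos-upper-≡ (m<m+n n (s≤s z≤n)) (trans (+-comm (suc n) (2 * n)) (2n+[1+n]≡3n+1 n))

  pos-2n∸1 : pos n (2 * n ∸ 1) ≡ suc (suc n)
  pos-2n∸1 = trans (cong (pos n) 2n∸1≡n+m) (pos-upper-≡ (m<m+n n 1≤m) (identity m))
    where
    identity : ∀ m → suc (suc (suc m)) + (suc m + m) ≡ 3 * suc m + 1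
    identity = solve-∀

  is-n : ∀ {q} → Strand n q → pos n q ≡ n → q ≡ n
  is-n sq e = pos-injective sq strand-n (trans e (sym (pos-lower ≤-refl)))

  is-2n : ∀ {q} → Strand n q → pos n q ≡ suc n → q ≡ 2 * n
  is-2n sq e = pos-injective sq strand-2n (trans e (sym pos-2n))

  is-2n∸1 : ∀ {q} → Strand n q → pos n q ≡ suc (suc n) → q ≡ 2 * n ∸ 1
  is-2n∸1 sq e = pos-injective sq strand-2n∸1 (trans e (sym pos-2n∸1))

  -- The two arrows cross: the first passes over n, whose own arrow lands above 2n.
  overtaken : ∀ {x y q} → (x , y) ∈ topArrows n → Strand n q → pos n x < pos n q → pos n q ≤ pos n y →
              Head (topArrows n) q ⊎ pos n y < pos n (greedyStep (topArrows n) q)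
  overtaken {q = q} (here refl) sq x<q q≤y
    with one-of-two (subst (_< pos n q) (pos-lower (n≤1+n m)) x<q) (subst (pos n q ≤_) pos-2n q≤y)
  ... | inj₁ e rewrite is-n sq e = inj₂ (subst₂ _<_ (sym pos-2n) (cong (pos n) (sym (topArrows-second {n} (s≤s z≤n))))
                                          (subst (suc n <_) (sym pos-2n∸1) (n<1+n (suc n))))
  ... | inj₂ e rewrite is-2n sq e = inj₁ (m , here refl)
  overtaken {q = q} (there (here refl)) sq x<q q≤y
    with one-of-two (subst (_< pos n q) (pos-lower ≤-refl) x<q) (subst (pos n q ≤_) pos-2n∸1 q≤y)
  ... | inj₁ e rewrite is-2n sq e = inj₁ (m , here refl)
  ... | inj₂ e rewrite is-2n∸1 sq e = inj₁ (n , there (here refl))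

wellFormed-top : ∀ {n} → 2 ≤ n → WellFormed n (arrows n n)
wellFormed-top {suc m} (s≤s 1≤m) = subst (WellFormed n) (sym (arrows-top n)) (record
  { head-strand   = λ { (here refl) → strand-2n ; (there (here refl)) → strand-2n∸1 }
  ; ascending     = λ { (here refl) → subst₂ _<_ (sym (pos-lower (n≤1+n m))) (sym pos-2n) (<-trans (n<1+n m) (n<1+n n))
                      ; (there (here refl)) → subst₂ _<_ (sym (pos-lower ≤-refl)) (sym pos-2n∸1)
                                                (<-trans (n<1+n n) (n<1+n (suc n))) }
  ; deterministic = λ { (here refl) → topArrows-first n ; (there (here refl)) → topArrows-second {n} (s≤s z≤n) }
  ; overtaken     = overtaken
  })
  where open TopArrows m 1≤m

wellFormed-arrows : ∀ {n i} → 2 ≤ n → 1 ≤ i → i ≤ n → WellFormed n (arrows n i)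
wellFormed-arrows 2≤n 1≤i i≤n with m≤n⇒m<n∨m≡n i≤n
... | inj₁ i<n  = wellFormed-low 1≤i i<n
... | inj₂ refl = wellFormed-top 2≤n

Occupied : ℕ → (ℕ → ℕ) → ℕ → Set
Occupied n C x = ∃ λ s → InN n s × C s ≡ x

record Admissible (n i : ℕ) (C : ℕ → ℕ) : Set where
  field
    symbol-positive : 1 ≤ i
    symbol-bounded  : i ≤ n
    tails-occupied  : ∀ {x y} → (x , y) ∈ arrows n i → Occupied n C x
    heads-free      : ∀ {x y} → (x , y) ∈ arrows n i → ¬ Occupied n C y

greedy-isPath : ∀ n a → IsPath n (greedy n a) a (greedy n a (N n))
greedy-isPath n a = refl , refl , λ l _ → greedyStep-moves (arrows n (idx n (suc l))) (greedy n a l)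

source-strand : ∀ {n s} → InN n s → Strand n s
source-strand {n} (1≤s , s≤n) = 1≤s , ≤-trans s≤n (n≤2n n)

module GreedyPaths (n : ℕ) (2≤n : 2 ≤ n)
  (admissible : ∀ l → l < N n → Admissible n (idx n (suc l)) (λ s → greedy n s l)) where

  private
    Step : ℕ → Arrows
    Step l = arrows n (idx n (suc l))

    wf : ∀ {l} → l < N n → WellFormed n (Step l)
    wf {l} l<N = wellFormed-arrows 2≤n symbol-positive symbol-bounded
      where open Admissible (admissible l l<N)

    greedy-free : ∀ {l s} → l < N n → InN n s → ¬ Head (Step l) (greedy n s l)
    greedy-free {l} l<N is (_ , arrow) = heads-free arrow (_ , is , refl)
      where open Admissible (admissible l l<N)

  greedy-strand : ∀ {s} l → InN n s → l ≤ N n → Strand n (greedy n s l)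
  greedy-strand zero    is _   = source-strand is
  greedy-strand (suc l) is l<N = move-strand (wf l<N) (greedy-strand l is (<⇒≤ l<N)) (greedyStep-moves (Step l) _)

  greedy-ordered : ∀ {s t} l → InN n s → InN n t → s < t → l ≤ N n →
                   pos n (greedy n s l) < pos n (greedy n t l)
  greedy-ordered zero (_ , s≤n) (_ , t≤n) s<t _ = subst₂ _<_ (sym (pos-lower s≤n)) (sym (pos-lower t≤n)) s<t
  greedy-ordered (suc l) is it s<t l<N =
    greedyStep-strictMono (wf l<N) (greedy-strand l it (<⇒≤ l<N)) (greedy-free l<N it)
      (greedy-ordered l is it s<t (<⇒≤ l<N))

  greedy-nonIntersecting : NonIntersecting n (greedy n)
  greedy-nonIntersecting a b ia ib a≢b l l≤N e with <-cmp a b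
  ... | tri< a<b _ _ = <⇒≢ (greedy-ordered l ia ib a<b l≤N) (cong (pos n) e)
  ... | tri≈ _ a≡b _ = a≢b a≡b
  ... | tri> _ _ b<a = >⇒≢ (greedy-ordered l ib ia b<a l≤N) (cong (pos n) e)

  greedy-covers-arrows : ∀ l → l < N n → ∀ a b → Arrow n (suc l) a b →
                         ∃ λ s → InN n s × greedy n s l ≡ a × greedy n s (suc l) ≡ b
  greedy-covers-arrows l l<N a b arrow with tails-occupied arrow
    where open Admissible (admissible l l<N)
  ... | s , is , refl = s , is , refl , WellFormed.deterministic (wf l<N) arrow

  module _ {c : ℕ → ℕ} {i k : ℕ} (ii : InN n i) (path : IsPath n c i k) where
    private
      path-move : ∀ {l} → l < N n → Move (Step l) (c l) (c (suc l))
      path-move l<N = proj₂ (proj₂ path) _ l<N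

    path-weakly-below : ∀ l → l ≤ N n → Strand n (c l) × pos n (c l) ≤ pos n (greedy n i l)
    path-weakly-below zero _ = subst (Strand n) (sym (proj₁ path)) (source-strand ii) , ≤-reflexive (cong (pos n) (proj₁ path))
    path-weakly-below (suc l) l<N =
      move-strand (wf l<N) (proj₁ below) (path-move l<N) ,
      move-stays-weakly-below (wf l<N) (proj₁ below) (greedy-strand l ii (<⇒≤ l<N)) (greedy-free l<N ii)
        (proj₂ below) (path-move l<N)
      where
      below : Strand n (c l) × pos n (c l) ≤ pos n (greedy n i l)
      below = path-weakly-below l (<⇒≤ l<N)

    path-strictly-below-persists : ∀ j {l} → j + l ≤ N n → pos n (c l) < pos n (greedy n i l) →
                                   pos n (c (j + l)) < pos n (greedy n i (j + l))
    path-strictly-below-persists zero    _   below = below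
    path-strictly-below-persists (suc j) {l} j+l<N below =
      move-stays-below (wf j+l<N) (greedy-strand (j + l) ii (<⇒≤ j+l<N)) (greedy-free j+l<N ii)
        (path-strictly-below-persists j (<⇒≤ j+l<N) below) (path-move j+l<N)

    no-path-above-greedy-sink : ¬ Above n k (greedy n i (N n))
    no-path-above-greedy-sink above =
      <⇒≱ above (subst (λ z → pos n z ≤ _) (proj₁ (proj₂ path)) (proj₂ (path-weakly-below (N n) ≤-refl)))

  module _ (P : ℕ → ℕ → ℕ) (paths : PathCollectionFromSources n P) (sinks : SameSinkSet n P (greedy n)) where

    sink-agrees-given-higher : ∀ {a} → InN n a → (∀ {b} → InN n b → a < b → P b (N n) ≡ greedy n b (N n)) →
                               P a (N n) ≡ greedy n a (N n)
    sink-agrees-given-higher {a} ia higher with proj₂ (sinks _) (a , ia , refl)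
    ... | b , ib , Pb≡ga with <-cmp a b
    ... | tri≈ _ refl _ = Pb≡ga
    ... | tri< a<b _ _ = ⊥-elim (<⇒≢ (greedy-ordered (N n) ia ib a<b ≤-refl) (cong (pos n) (trans (sym Pb≡ga) (higher ib a<b))))
    ... | tri> _ _ b<a = ⊥-elim (<⇒≱ (greedy-ordered (N n) ib ia b<a ≤-refl)
                           (subst (λ z → pos n z ≤ _) Pb≡ga (proj₂ (path-weakly-below ib (paths b ib) (N n) ≤-refl))))

    sinks-agree : ∀ d {a} → InN n a → n ≤ d + a → P a (N n) ≡ greedy n a (N n)
    sinks-agree d ia n≤d+a = sink-agrees-given-higher ia (higher d n≤d+a)
      where
      higher : ∀ d {a b} → n ≤ d + a → InN n b → a < b → P b (N n) ≡ greedy n b (N n)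
      higher zero    n≤a   (_ , b≤n) a<b = ⊥-elim (<⇒≱ a<b (≤-trans b≤n n≤a))
      higher (suc d) n≤d+a ib        a<b =
        sinks-agree d ib (≤-trans n≤d+a (≤-trans (≤-reflexive (sym (+-suc d _))) (+-monoʳ-≤ d a<b)))

    greedy-unique : ∀ a → InN n a → ∀ l → l ≤ N n → P a l ≡ greedy n a l
    greedy-unique a ia l l≤N with m≤n⇒m<n∨m≡n (proj₂ (path-weakly-below ia (paths a ia) l l≤N))
    ... | inj₂ same = pos-injective (proj₁ (path-weakly-below ia (paths a ia) l l≤N)) (greedy-strand l ia l≤N) same
    ... | inj₁ below = ⊥-elim (<⇒≢ (subst₂ (λ x y → pos n (P a x) < pos n (greedy n a y)) N∸l+l≡N N∸l+l≡N
                         (path-strictly-below-persists ia (paths a ia) (N n ∸ l) (≤-reflexive N∸l+l≡N) below))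
                         (cong (pos n) (sinks-agree n ia (m≤m+n n a))))
      where
      N∸l+l≡N : N n ∸ l + l ≡ N n
      N∸l+l≡N = m∸n+n≡m l≤N

run : ℕ → List ℕ → ℕ → ℕ
run n w c = foldl (λ c i → greedyStep (arrows n i) c) c w

run-++ : ∀ n xs ys c → run n (xs ++ ys) c ≡ run n ys (run n xs c)
run-++ n xs ys c = foldl-++ (λ c i → greedyStep (arrows n i) c) c xs ys

AllAdmissible : ℕ → List ℕ → (ℕ → ℕ) → Set
AllAdmissible n []      C = ⊤
AllAdmissible n (i ∷ w) C = Admissible n i C × AllAdmissible n w (greedyStep (arrows n i) ∘ C)

allAdmissible-++ : ∀ {n} xs {ys C} → AllAdmissible n xs C → AllAdmissible n ys (run n xs ∘ C) →
                   AllAdmissible n (xs ++ ys) C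
allAdmissible-++ []       _            rest = rest
allAdmissible-++ (i ∷ xs) (first , xs✓) rest = first , allAdmissible-++ xs xs✓ rest

n<n+x+1 : ∀ n x → n < n + x + 1
n<n+x+1 n x = ≤-<-trans (m≤m+n n x) (m<m+n (n + x) z<s)

≡<⇒≢ : ∀ {x v y} → x ≡ v → v < y → x ≢ y
≡<⇒≢ refl = <⇒≢

≡>⇒≢ : ∀ {x v y} → x ≡ v → y < v → x ≢ y
≡>⇒≢ refl = >⇒≢

-- Sweep follows one descending run s_{d+c} ⋯ s_{c+1}; State t is the configuration while its last
-- t symbols remain.  Sources 1,…,d each move up one strand, the mover m walks down the upper
-- strands n+d+c+1, …, n+c+1, and every other source rests outside that window (Parked).
Parked : ℕ → ℕ → ℕ → ℕ → Set
Parked n c d x = n < x × (x ≤ n + c ⊎ n + (d + c) + 1 < x)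

module Sweep (n c d m : ℕ) (d+c<n : d + c < n) (d<m : d < m) (m≤n : m ≤ n) (C₀ : ℕ → ℕ)
  (parked : ∀ a → d < a → a ≤ n → a ≢ m → Parked n c d (C₀ a)) where

  record State (t : ℕ) (C : ℕ → ℕ) : Set where
    field
      settled : ∀ a → 1 ≤ a → a ≤ t → C a ≡ a + c
      shifted : ∀ a → t < a → a ≤ d → C a ≡ suc (a + c)
      mover   : C m ≡ n + (t + c) + 1
      resting : ∀ a → d < a → a ≤ n → a ≢ m → C a ≡ C₀ a

  module SweepStep {t : ℕ} {C : ℕ → ℕ} (t<d : suc t ≤ d) (st : State (suc t) C) where
    open State st

    i : ℕ
    i = suc t + c

    i≤d+c : i ≤ d + c
    i≤d+c = +-monoˡ-≤ c t<d

    i<n : i < n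
    i<n = ≤-<-trans i≤d+c d+c<n

    n<n+i+1 : n < n + i + 1
    n<n+i+1 = n<n+x+1 n i

    n+c<n+i : n + c < n + i
    n+c<n+i = +-monoʳ-< n (s≤s (m≤n+m c t))

    lower-≤-n : ∀ a → 1 ≤ a → a ≤ d → C a ≤ n
    lower-≤-n a 1≤a a≤d with a ≤? suc t
    ... | yes a≤st = subst (_≤ n) (sym (settled a 1≤a a≤st)) (≤-trans (+-monoˡ-≤ c a≤d) (<⇒≤ d+c<n))
    ... | no a≰st  = subst (_≤ n) (sym (shifted a (≰⇒> a≰st) a≤d)) (≤-trans (s≤s (+-monoˡ-≤ c a≤d)) d+c<n)

    upper->-n : ∀ a → d < a → a ≤ n → n < C a
    upper->-n a d<a a≤n with a ≟ m
    ... | yes refl = subst (n <_) (sym mover) n<n+i+1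
    ... | no a≢m   = subst (n <_) (sym (resting a d<a a≤n a≢m)) (proj₁ (parked a d<a a≤n a≢m))

    resting-outside-window : ∀ a → d < a → a ≤ n → a ≢ m → ∀ {y} → n + c < y → y ≤ n + (d + c) + 1 → C a ≢ y
    resting-outside-window a d<a a≤n a≢m n+c<y y≤top with proj₂ (parked a d<a a≤n a≢m)
    ... | inj₁ C₀a≤n+c = ≡<⇒≢ (resting a d<a a≤n a≢m) (≤-<-trans C₀a≤n+c n+c<y)
    ... | inj₂ top<C₀a = ≡>⇒≢ (resting a d<a a≤n a≢m) (≤-<-trans y≤top top<C₀a)

    n+i+1≤top : n + i + 1 ≤ n + (d + c) + 1
    n+i+1≤top = +-monoˡ-≤ 1 (+-monoʳ-≤ n i≤d+c)

    lower-head-free : ∀ a → InN n a → C a ≢ suc i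
    lower-head-free a (1≤a , a≤n) with a ≤? suc t
    ... | yes a≤st = ≡<⇒≢ (settled a 1≤a a≤st) (s≤s (+-monoˡ-≤ c a≤st))
    ... | no a≰st with a ≤? d
    ...   | yes a≤d = ≡>⇒≢ (shifted a (≰⇒> a≰st) a≤d) (s≤s (+-monoˡ-< c (≰⇒> a≰st)))
    ...   | no a≰d  = >⇒≢ (≤-<-trans i<n (upper->-n a (≰⇒> a≰d) a≤n))

    upper-head-free : ∀ a → InN n a → C a ≢ n + i
    upper-head-free a (1≤a , a≤n) with a ≤? d
    ... | yes a≤d = <⇒≢ (≤-<-trans (lower-≤-n a 1≤a a≤d) (m<m+n n z<s))
    ... | no a≰d with a ≟ m
    ...   | yes refl = ≡>⇒≢ mover (m<m+n (n + i) z<s)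
    ...   | no a≢m   = resting-outside-window a (≰⇒> a≰d) a≤n a≢m n+c<n+i
                          (≤-trans (n≤1+n (n + i)) (≤-trans (≤-reflexive (+-comm 1 (n + i))) n+i+1≤top))

    admissible : Admissible n i C
    admissible = record
      { symbol-positive = s≤s z≤n
      ; symbol-bounded  = <⇒≤ i<n
      ; tails-occupied  = occupied ∘ subst (λ L → _ ∈ L) (arrows-low i<n)
      ; heads-free      = free ∘ subst (λ L → _ ∈ L) (arrows-low i<n)
      }
      where
      occupied : ∀ {x y} → (x , y) ∈ lowArrows n i → Occupied n C x
      occupied (here refl)         =
        suc t , (s≤s z≤n , ≤-trans t<d (<⇒≤ (<-≤-trans d<m m≤n))) , settled (suc t) (s≤s z≤n) ≤-refl
      occupied (there (here refl)) = m , (≤-trans (s≤s z≤n) d<m , m≤n) , mover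
      free : ∀ {x y} → (x , y) ∈ lowArrows n i → ¬ Occupied n C y
      free (here refl)         (a , ia , Ca≡y) = lower-head-free a ia Ca≡y
      free (there (here refl)) (a , ia , Ca≡y) = upper-head-free a ia Ca≡y

    step : ℕ → ℕ
    step = greedyStep (arrows n i)

    next : State t (step ∘ C)
    next = record
      { settled = λ a 1≤a a≤t → trans (cong step (settled a 1≤a (≤-trans a≤t (n≤1+n t))))
                    (lowStep-idle i<n (<⇒≢ (a+c<i a≤t)) (<⇒≢ (<-trans (a+c<i a≤t) (i<n+i+1 n i))))
      ; shifted = shifted′
      ; mover   = trans (cong step mover) (trans (lowStep-upper i<n) (sym (n+i+1≡n+[1+i] n (t + c))))
      ; resting = λ a d<a a≤n a≢m → trans (cong step (resting a d<a a≤n a≢m))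
                    (lowStep-idle i<n (>⇒≢ (<-trans i<n (proj₁ (parked a d<a a≤n a≢m))))
                      (λ e → resting-outside-window a d<a a≤n a≢m (<-trans n+c<n+i (m<m+n (n + i) z<s)) n+i+1≤top
                               (trans (resting a d<a a≤n a≢m) e)))
      }
      where
      a+c<i : ∀ {a} → a ≤ t → a + c < i
      a+c<i a≤t = s≤s (+-monoˡ-≤ c a≤t)
      shifted′ : ∀ a → t < a → a ≤ d → step (C a) ≡ suc (a + c)
      shifted′ a t<a a≤d with m≤n⇒m<n∨m≡n t<a
      ... | inj₂ refl = trans (cong step (settled (suc t) (s≤s z≤n) ≤-refl)) (lowStep-lower i<n)
      ... | inj₁ st<a = trans (cong step (shifted a st<a a≤d))
                          (lowStep-idle i<n (>⇒≢ (s≤s (<⇒≤ (+-monoˡ-< c st<a))))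
                            (<⇒≢ (≤-<-trans (≤-trans (s≤s (+-monoˡ-≤ c a≤d)) d+c<n) n<n+i+1)))

  sweep : ∀ t {C} → t ≤ d → State t C →
          AllAdmissible n (descAux t (t + c)) C × State 0 (run n (descAux t (t + c)) ∘ C)
  sweep zero    _   st = tt , st
  sweep (suc t) t<d st with sweep t (<⇒≤ t<d) (SweepStep.next t<d st)
  ... | rest✓ , final = (SweepStep.admissible t<d st , rest✓) , final

topStep-first : ∀ n → greedyStep (arrows n n) (n ∸ 1) ≡ 2 * n
topStep-first n rewrite arrows-top n = topArrows-first n

topStep-second : ∀ {n} → 1 ≤ n → greedyStep (arrows n n) n ≡ 2 * n ∸ 1
topStep-second {n} 1≤n rewrite arrows-top n = topArrows-second 1≤n

topStep-idle : ∀ {n x} → x ≢ n ∸ 1 → x ≢ n → greedyStep (arrows n n) x ≡ x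
topStep-idle {n} {x} x≢n∸1 x≢n rewrite arrows-top n =
  trans (greedyStep-miss (n ∸ 1) (2 * n) ((n , 2 * n ∸ 1) ∷ []) (x≢n∸1 ∘ sym))
        (greedyStep-miss n (2 * n ∸ 1) [] (x≢n ∘ sym))

record Staircase (n b r : ℕ) (C : ℕ → ℕ) : Set where
  field
    lower : ∀ a → 1 ≤ a → a ≤ r → C a ≡ a + b
    upper : ∀ a → r < a → a ≤ n → n < C a × C a ≤ n + b

staircase-cong : ∀ {n b r C D} → (∀ s → C s ≡ D s) → Staircase n b r C → Staircase n b r D
staircase-cong {n} {b} C≗D stair = record
  { lower = λ a 1≤a a≤r → trans (sym (C≗D a)) (lower a 1≤a a≤r)
  ; upper = λ a r<a a≤n → subst (λ x → n < x × x ≤ n + b) (C≗D a) (upper a r<a a≤n)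
  }
  where open Staircase stair

blockWord : ℕ → ℕ → List ℕ
blockWord b d = suc (suc (d + b)) ∷ (descAux d (d + b) ++ descAux d (d + suc b))

-- The block B_m with b = 2m-2 and n = d+b+2: the step s_n, then a sweep with c = b whose mover is
-- source d+2, then a sweep with c = b+1 whose mover is source d+1.
module Block (b d : ℕ) {C : ℕ → ℕ} (stair : Staircase (suc (suc (d + b))) b (suc (suc d)) C) where
  open Staircase stair

  n : ℕ
  n = suc (suc (d + b))

  2n≡n+[d+b]+2 : 2 * n ≡ suc (n + (d + b) + 1)
  2n≡n+[d+b]+2 = identity d b
    where
    identity : ∀ d b → 2 * suc (suc (d + b)) ≡ suc (suc (suc (d + b)) + (d + b) + 1)
    identity = solve-∀

  2n∸1≡n+[d+b]+1 : 2 * n ∸ 1 ≡ n + (d + b) + 1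
  2n∸1≡n+[d+b]+1 = trans (2[1+m]∸1≡[1+m]+m (suc (d + b))) (sym (n+i+1≡n+[1+i] n (d + b)))

  C₁ : ℕ → ℕ
  C₁ = greedyStep (arrows n n) ∘ C

  C₁-lower : ∀ a → 1 ≤ a → a ≤ d → C₁ a ≡ a + b
  C₁-lower a 1≤a a≤d =
    trans (cong (greedyStep (arrows n n)) (lower a 1≤a (≤-trans a≤d (≤-trans (n≤1+n d) (n≤1+n (suc d))))))
    (topStep-idle (<⇒≢ (s≤s (+-monoˡ-≤ b a≤d))) (<⇒≢ (≤-<-trans (+-monoˡ-≤ b a≤d) (<-trans (n<1+n _) (n<1+n _)))))

  C₁-first : C₁ (suc d) ≡ 2 * n
  C₁-first = trans (cong (greedyStep (arrows n n)) (lower (suc d) (s≤s z≤n) (n≤1+n (suc d)))) (topStep-first n)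

  C₁-second : C₁ (suc (suc d)) ≡ n + (d + b) + 1
  C₁-second = trans (cong (greedyStep (arrows n n)) (lower (suc (suc d)) (s≤s z≤n) ≤-refl))
                (trans (topStep-second {n} (s≤s z≤n)) 2n∸1≡n+[d+b]+1)

  C₁-upper : ∀ a → suc (suc d) < a → a ≤ n → C₁ a ≡ C a
  C₁-upper a ssd<a a≤n = topStep-idle (>⇒≢ (<-trans (n<1+n _) n<Ca)) (>⇒≢ n<Ca)
    where
    n<Ca : n < C a
    n<Ca = proj₁ (upper a ssd<a a≤n)

  top-admissible : Admissible n n C
  top-admissible = record
    { symbol-positive = s≤s z≤n
    ; symbol-bounded  = ≤-refl
    ; tails-occupied  = occupied ∘ subst (λ L → _ ∈ L) (arrows-top n)
    ; heads-free      = free ∘ subst (λ L → _ ∈ L) (arrows-top n)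
    }
    where
    C≤n+b : ∀ a → InN n a → C a ≤ n + b
    C≤n+b a (1≤a , a≤n) with a ≤? suc (suc d)
    ... | yes a≤ssd = subst (_≤ n + b) (sym (lower a 1≤a a≤ssd)) (≤-trans (+-monoˡ-≤ b a≤ssd) (m≤m+n n b))
    ... | no a≰ssd  = proj₂ (upper a (≰⇒> a≰ssd) a≤n)
    n+b<2n∸1 : n + b < 2 * n ∸ 1
    n+b<2n∸1 = subst (n + b <_) (sym 2n∸1≡n+[d+b]+1) (≤-<-trans (+-monoʳ-≤ n (m≤n+m b d)) (m<m+n (n + (d + b)) z<s))
    occupied : ∀ {x y} → (x , y) ∈ topArrows n → Occupied n C x
    occupied (here refl)         =
      suc d , (s≤s z≤n , ≤-trans (s≤s (m≤m+n d b)) (n≤1+n _)) , lower (suc d) (s≤s z≤n) (n≤1+n (suc d))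
    occupied (there (here refl)) = suc (suc d) , (s≤s z≤n , s≤s (s≤s (m≤m+n d b))) , lower (suc (suc d)) (s≤s z≤n) ≤-refl
    free : ∀ {x y} → (x , y) ∈ topArrows n → ¬ Occupied n C y
    free (here refl)         (a , ia , Ca≡2n)   =
      <⇒≢ (≤-<-trans (C≤n+b a ia) (<-≤-trans n+b<2n∸1 (m∸n≤m (2 * n) 1))) Ca≡2n
    free (there (here refl)) (a , ia , Ca≡2n∸1) = <⇒≢ (≤-<-trans (C≤n+b a ia) n+b<2n∸1) Ca≡2n∸1

  parked₁ : ∀ a → d < a → a ≤ n → a ≢ suc (suc d) → Parked n b d (C₁ a)
  parked₁ a d<a a≤n a≢ssd with m≤n⇒m<n∨m≡n d<a
  ... | inj₂ refl = subst (Parked n b d) (sym C₁-first)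
                      (m<m+n n z<s , inj₂ (subst (n + (d + b) + 1 <_) (sym 2n≡n+[d+b]+2) (n<1+n _)))
  ... | inj₁ sd<a = subst (Parked n b d) (sym (C₁-upper a ssd<a a≤n))
                      (proj₁ (upper a ssd<a a≤n) , inj₁ (proj₂ (upper a ssd<a a≤n)))
    where
    ssd<a : suc (suc d) < a
    ssd<a = ≤∧≢⇒< sd<a (a≢ssd ∘ sym)

  module Phase₁ = Sweep n b d (suc (suc d)) (<-trans (n<1+n _) (n<1+n _)) (<-trans (n<1+n d) (n<1+n (suc d)))
                        (s≤s (s≤s (m≤m+n d b))) C₁ parked₁

  C₂ : ℕ → ℕ
  C₂ = run n (descAux d (d + b)) ∘ C₁

  phase₁ : AllAdmissible n (descAux d (d + b)) C₁ × Phase₁.State 0 C₂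
  phase₁ = Phase₁.sweep d ≤-refl (record
    { settled = C₁-lower
    ; shifted = λ a d<a a≤d → ⊥-elim (<⇒≱ d<a a≤d)
    ; mover   = C₁-second
    ; resting = λ _ _ _ _ → refl
    })

  C₂-lower : ∀ a → 1 ≤ a → a ≤ d → C₂ a ≡ a + suc b
  C₂-lower a 1≤a a≤d = trans (Phase₁.State.shifted (proj₂ phase₁) a 1≤a a≤d) (sym (+-suc a b))

  C₂-first : C₂ (suc d) ≡ n + (d + suc b) + 1
  C₂-first = trans (Phase₁.State.resting (proj₂ phase₁) (suc d) (n<1+n d) (≤-trans (s≤s (m≤m+n d b)) (n≤1+n _))
                                          (<⇒≢ (n<1+n _)))
               (trans C₁-first (identity d b))
    where
    identity : ∀ d b → 2 * suc (suc (d + b)) ≡ suc (suc (d + b)) + (d + suc b) + 1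
    identity = solve-∀

  C₂-parked : ∀ a → suc d < a → a ≤ n → n < C₂ a × C₂ a ≤ n + suc b
  C₂-parked a sd<a a≤n with m≤n⇒m<n∨m≡n sd<a
  ... | inj₂ refl = subst (λ x → n < x × x ≤ n + suc b) (sym (Phase₁.State.mover (proj₂ phase₁)))
                      (n<n+x+1 n b , ≤-reflexive (n+i+1≡n+[1+i] n b))
  ... | inj₁ ssd<a = subst (λ x → n < x × x ≤ n + suc b)
                       (sym (trans (Phase₁.State.resting (proj₂ phase₁) a d<a a≤n (>⇒≢ ssd<a)) (C₁-upper a ssd<a a≤n)))
                       (proj₁ (upper a ssd<a a≤n) , ≤-trans (proj₂ (upper a ssd<a a≤n)) (+-monoʳ-≤ n (n≤1+n b)))
    where
    d<a : d < a
    d<a = <-trans (n<1+n d) sd<a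

  parked₂ : ∀ a → d < a → a ≤ n → a ≢ suc d → Parked n (suc b) d (C₂ a)
  parked₂ a d<a a≤n a≢sd = proj₁ (C₂-parked a sd<a a≤n) , inj₁ (proj₂ (C₂-parked a sd<a a≤n))
    where
    sd<a : suc d < a
    sd<a = ≤∧≢⇒< d<a (a≢sd ∘ sym)

  module Phase₂ = Sweep n (suc b) d (suc d) (subst (_< n) (sym (+-suc d b)) (n<1+n _)) (n<1+n d)
                        (≤-trans (s≤s (m≤m+n d b)) (n≤1+n _)) C₂ parked₂

  C₃ : ℕ → ℕ
  C₃ = run n (descAux d (d + suc b)) ∘ C₂

  phase₂ : AllAdmissible n (descAux d (d + suc b)) C₂ × Phase₂.State 0 C₃
  phase₂ = Phase₂.sweep d ≤-refl (record
    { settled = C₂-lower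
    ; shifted = λ a d<a a≤d → ⊥-elim (<⇒≱ d<a a≤d)
    ; mover   = C₂-first
    ; resting = λ _ _ _ _ → refl
    })

  final : Staircase n (suc (suc b)) d C₃
  final = record
    { lower = λ a 1≤a a≤d → trans (Phase₂.State.shifted (proj₂ phase₂) a 1≤a a≤d) (sym (+-suc a (suc b)))
    ; upper = upper′
    }
    where
    upper′ : ∀ a → d < a → a ≤ n → n < C₃ a × C₃ a ≤ n + suc (suc b)
    upper′ a d<a a≤n with a ≟ suc d
    ... | yes refl = subst (λ x → n < x × x ≤ n + suc (suc b)) (sym (Phase₂.State.mover (proj₂ phase₂)))
                       (n<n+x+1 n (suc b) , ≤-reflexive (n+i+1≡n+[1+i] n (suc b)))
    ... | no a≢sd  = subst (λ x → n < x × x ≤ n + suc (suc b)) (sym (Phase₂.State.resting (proj₂ phase₂) a d<a a≤n a≢sd))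
                       (proj₁ parked , ≤-trans (proj₂ parked) (+-monoʳ-≤ n (n≤1+n (suc b))))
      where
      parked : n < C₂ a × C₂ a ≤ n + suc b
      parked = C₂-parked a (≤∧≢⇒< d<a (a≢sd ∘ sym)) a≤n

  block-admissible : AllAdmissible n (blockWord b d) C
  block-admissible = top-admissible , allAdmissible-++ (descAux d (d + b)) (proj₁ phase₁) (proj₁ phase₂)

  block-staircase : Staircase n (suc (suc b)) d (run n (blockWord b d) ∘ C)
  block-staircase = staircase-cong (λ s → sym (run-++ n (descAux d (d + b)) (descAux d (d + suc b)) (C₁ s))) final

2[1+h]≡2+2h : ∀ h → 2 * suc h ≡ suc (suc (2 * h))
2[1+h]≡2+2h = solve-∀

B≡blockWord : ∀ b d m → 2 * m ≡ suc (suc b) → B (suc (suc (d + b))) m ≡ blockWord b d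
B≡blockWord b d m 2m≡2+b rewrite 2m≡2+b | m+n∸n≡m d b =
  cong (λ x → suc (suc (d + b)) ∷ (descAux d (d + b) ++ descAux d x)) (sym (+-suc d b))

block-decomposition : ∀ {n h} → 2 * suc h ≤ n → ∃ λ d → suc (suc (d + 2 * h)) ≡ n
block-decomposition {n} {h} 2[1+h]≤n with m≤n⇒∃[o]m+o≡n 2[1+h]≤n
... | d , e = d , trans (identity h d) e
  where
  identity : ∀ h d → suc (suc (d + 2 * h)) ≡ 2 * suc h + d
  identity = solve-∀

n∸2[1+h]≡d : ∀ d h → suc (suc (d + 2 * h)) ∸ 2 * suc h ≡ d
n∸2[1+h]≡d d h = trans (cong (suc (suc (d + 2 * h)) ∸_) (2[1+h]≡2+2h h)) (m+n∸n≡m d (2 * h))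

blocks-admissible : ∀ n h → 2 * h ≤ n →
                    AllAdmissible n (blocks n h) id × Staircase n (2 * h) (n ∸ 2 * h) (run n (blocks n h))
blocks-admissible n zero _ = tt , record
  { lower = λ a _ _ → sym (+-identityʳ a)
  ; upper = λ a n<a a≤n → ⊥-elim (<⇒≱ n<a a≤n)
  }
blocks-admissible n (suc h) 2[1+h]≤n with block-decomposition 2[1+h]≤n
... | d , refl =
  allAdmissible-++ (blocks n h) (proj₁ previous)
    (subst (λ w → AllAdmissible n w (run n (blocks n h))) (sym B≡) (Block.block-admissible b d stair)) ,
  subst₂ (λ b′ r → Staircase n b′ r (run n (blocks n h ++ B n (suc h)))) (sym (2[1+h]≡2+2h h)) (sym (n∸2[1+h]≡d d h))
    (staircase-cong (λ s → sym (trans (run-++ n (blocks n h) (B n (suc h)) s) (cong (λ w → run n w (run n (blocks n h) s)) B≡)))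
      (Block.block-staircase b d stair))
  where
  b : ℕ
  b = 2 * h
  B≡ : B n (suc h) ≡ blockWord b d
  B≡ = B≡blockWord b d (suc h) (2[1+h]≡2+2h h)
  previous : AllAdmissible n (blocks n h) id × Staircase n b (n ∸ b) (run n (blocks n h))
  previous = blocks-admissible n h (m≤n+m b (suc (suc d)))
  stair : Staircase n b (suc (suc d)) (run n (blocks n h))
  stair = subst (λ r → Staircase n b r (run n (blocks n h))) (m+n∸n≡m (suc (suc d)) b) (proj₂ previous)

length-descAux : ∀ k a → length (descAux k a) ≡ k
length-descAux zero    a = refl
length-descAux (suc k) a = cong suc (length-descAux k (a ∸ 1))

length-blockWord : ∀ b d → length (blockWord b d) ≡ suc (d + d)
length-blockWord b d = cong suc (trans (length-++ (descAux d (d + b)))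
  (cong₂ _+_ (length-descAux d (d + b)) (length-descAux d (d + suc b))))

[1+x]C2 : ∀ x → suc x choose 2 ≡ x + x choose 2
[1+x]C2 x = trans (sym (nCk+nC[k+1]≡[n+1]C[k+1] x 1)) (cong (_+ x choose 2) (nC1≡n x))

blocks-length : ∀ n h → 2 * h ≤ n → length (blocks n h) + (n ∸ 2 * h) choose 2 ≡ n choose 2
blocks-length n zero    _        = refl
blocks-length n (suc h) 2[1+h]≤n with block-decomposition 2[1+h]≤n
... | d , refl = begin
  length (blocks n h ++ B n (suc h)) + (n ∸ 2 * suc h) choose 2
    ≡⟨ cong₂ (λ w r → length (blocks n h ++ w) + r choose 2)
             (B≡blockWord b d (suc h) (2[1+h]≡2+2h h)) (n∸2[1+h]≡d d h) ⟩
  length (blocks n h ++ blockWord b d) + d choose 2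
    ≡⟨ cong (_+ d choose 2) (trans (length-++ (blocks n h)) (cong (length (blocks n h) +_) (length-blockWord b d))) ⟩
  length (blocks n h) + suc (d + d) + d choose 2
    ≡⟨ +-assoc (length (blocks n h)) (suc (d + d)) (d choose 2) ⟩
  length (blocks n h) + suc (d + d + d choose 2)
    ≡⟨ cong (length (blocks n h) +_) (sym ssd-choose-2) ⟩
  length (blocks n h) + suc (suc d) choose 2
    ≡⟨ cong (λ r → length (blocks n h) + r choose 2) (sym (m+n∸n≡m (suc (suc d)) b)) ⟩
  length (blocks n h) + (n ∸ b) choose 2
    ≡⟨ blocks-length n h (m≤n+m b (suc (suc d))) ⟩
  n choose 2 ∎
  where
  open ≡-Reasoning
  b : ℕ
  b = 2 * h
  ssd-choose-2 : suc (suc d) choose 2 ≡ suc (d + d + d choose 2)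
  ssd-choose-2 = trans ([1+x]C2 (suc d)) (cong suc (trans (cong (d +_) ([1+x]C2 d)) (sym (+-assoc d d (d choose 2)))))

length-word : ∀ n → length (word n) ≡ N n
length-word n = begin
  length (word n)                            ≡⟨ sym (+-identityʳ _) ⟩
  length (word n) + 0                        ≡⟨ cong (length (word n) +_) (sym (small-C2 (m%n<n n 2))) ⟩
  length (word n) + (n % 2) choose 2              ≡⟨ cong (λ r → length (word n) + r choose 2) n%2≡n∸2[n/2] ⟩
  length (word n) + (n ∸ 2 * (n / 2)) choose 2    ≡⟨ blocks-length n (n / 2) (subst (_≤ n) (*-comm (n / 2) 2) (m/n*n≤m n 2)) ⟩
  n choose 2                                      ∎
  where
  open ≡-Reasoning
  small-C2 : ∀ {r} → r < 2 → r choose 2 ≡ 0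
  small-C2 {zero}  _ = refl
  small-C2 {suc zero} _ = refl
  small-C2 {suc (suc r)} (s≤s (s≤s ()))
  n%2≡n∸2[n/2] : n % 2 ≡ n ∸ 2 * (n / 2)
  n%2≡n∸2[n/2] = trans (m%n≡m∸m/n*n n 2) (cong (n ∸_) (*-comm (n / 2) 2))

trace : ℕ → List ℕ → ℕ → ℕ → ℕ
trace n w c zero    = c
trace n w c (suc l) = greedyStep (arrows n (at w (suc l))) (trace n w c l)

trace-∷ : ∀ n i w c l → trace n (i ∷ w) c (suc l) ≡ trace n w (greedyStep (arrows n i) c) l
trace-∷ n i w c zero    = refl
trace-∷ n i w c (suc l) = cong (greedyStep (arrows n (at w (suc l)))) (trace-∷ n i w c l)

greedy≡trace : ∀ n s l → greedy n s l ≡ trace n (word n) s l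
greedy≡trace n s zero    = refl
greedy≡trace n s (suc l) = cong (greedyStep (arrows n (idx n (suc l)))) (greedy≡trace n s l)

occupied-cong : ∀ {n C D x} → (∀ s → C s ≡ D s) → Occupied n C x → Occupied n D x
occupied-cong C≗D (s , is , Cs≡x) = s , is , trans (sym (C≗D s)) Cs≡x

admissible-cong : ∀ {n i C D} → (∀ s → C s ≡ D s) → Admissible n i C → Admissible n i D
admissible-cong C≗D adm = record
  { symbol-positive = symbol-positive
  ; symbol-bounded  = symbol-bounded
  ; tails-occupied  = λ arrow → occupied-cong C≗D (tails-occupied arrow)
  ; heads-free      = λ arrow → heads-free arrow ∘ occupied-cong (sym ∘ C≗D)
  }
  where open Admissible adm

allAdmissible-at : ∀ {n} w {C} → AllAdmissible n w C → ∀ l → l < length w →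
                   Admissible n (at w (suc l)) (λ s → trace n w (C s) l)
allAdmissible-at (i ∷ w) (first , _)    zero    _ = first
allAdmissible-at (i ∷ w) {C} (_ , rest) (suc l) (s≤s l<∣w∣) =
  admissible-cong (λ s → sym (trace-∷ _ i w (C s) l)) (allAdmissible-at w rest l l<∣w∣)

word-admissible : ∀ n l → l < N n → Admissible n (idx n (suc l)) (λ s → greedy n s l)
word-admissible n l l<N = admissible-cong (λ s → sym (greedy≡trace n s l))
  (allAdmissible-at (word n) (proj₁ (blocks-admissible n (n / 2) 2[n/2]≤n)) l (subst (l <_) (sym (length-word n)) l<N))
  where
  2[n/2]≤n : 2 * (n / 2) ≤ n
  2[n/2]≤n = subst (_≤ n) (*-comm (n / 2) 2) (m/n*n≤m n 2)

lemma3p1 : ∀ n → 2 ≤ n →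
      ((∀ a → InN n a → IsPath n (greedy n a) a (greedy n a (N n)))
    × NonIntersecting n (greedy n)
    × (∀ (P : ℕ → ℕ → ℕ) → PathCollectionFromSources n P → NonIntersecting n P →
         SameSinkSet n P (greedy n) →
         ∀ a → InN n a → ∀ l → l ≤ N n → P a l ≡ greedy n a l)
    × (∀ l → l < N n → ∀ a b → Arrow n (suc l) a b →
         ∃ λ s → InN n s × greedy n s l ≡ a × greedy n s (suc l) ≡ b)
    × (∀ i → InN n i → ∀ (c : ℕ → ℕ) k → IsPath n c i k →
         ¬ Above n k (greedy n i (N n))))
lemma3p1 n 2≤n =
    (λ a _ → greedy-isPath n a)
  , greedy-nonIntersecting
  , (λ P paths _ sinks → greedy-unique P paths sinks)
  , greedy-covers-arrows
  , (λ i ii c k path → no-path-above-greedy-sink ii path)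
  where open GreedyPaths n 2≤n (word-admissible n)
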